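{- Let $b \geq d \geq D \geq 1$ be integers with $b \geq 2$, $d > 1$, and $\beta := b - D \geq 2$, and let $c(x) := c_{b,\beta}(x/d)$ for $x \in \mathbb{Q}_{\geq 0}$. Suppose $D < d \leq b - 2$ and at least one of the following holds: (1) $d \leq b/2$; (2) $D < d\left(1 - \frac{1}{b-d}\right)$. Then $c(D) \geq \dfrac{D(\beta+1)}{\beta(\beta-1)}$.
   Context: For a base $b \geq 2$, each real $x \geq 0$ has a unique normal base-$b$ expansion $x = \sum_i x_i b^i$ (digits in $\{0,\dots,b-1\}$, $x_i=0$ for $i\gg0$, not ending in infinitely many digits $b-1$). The $(b,\beta)$-content is $c_{b,\beta}(x) := \sum_i x_i \beta^i$. -}

module Defs where

open import Data.Nat as ℕ using (ℕ; zero; suc; _^_; _≤_; _<_)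
open import Data.Nat.DivMod using (_/_; _%_)
open import Data.Integer using (+_)
open import Data.Rational as ℚ using (ℚ; 0ℚ)
open import Data.Product using (∃-syntax; _×_)

-- safe natural division and remainder (value 0 for divisor 0; never used
-- with divisor 0 below under the theorem's hypotheses)
_div_ : ℕ → ℕ → ℕ
m div zero    = 0
m div (suc n) = m / suc n

_mod_ : ℕ → ℕ → ℕ
m mod zero    = 0
m mod (suc n) = m % suc n

frac : ℕ → ℕ → ℚ
frac p zero    = 0ℚ
frac p (suc q) = (+ p) ℚ./ suc q

-- Digits of the normal base-b expansion of the nonnegative rational x = p/q.
-- Integer-position digit x_j (j ≥ 0):   ⌊ x / b^j ⌋ mod b
intDigit : (b p q j : ℕ) → ℕ
intDigit b p q j = (p div (q ℕ.* b ^ j)) mod b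

fracDigit : (b p q k : ℕ) → ℕ
fracDigit b p q k = ((p ℕ.* b ^ k) div q) mod b

intPart : (b β p q N : ℕ) → ℚ
intPart b β p q zero    = frac (intDigit b p q 0) 1
intPart b β p q (suc N) = intPart b β p q N ℚ.+ frac (intDigit b p q (suc N) ℕ.* β ^ suc N) 1

fracPart : (b β p q N : ℕ) → ℚ
fracPart b β p q zero    = 0ℚ
fracPart b β p q (suc N) = fracPart b β p q N ℚ.+ frac (fracDigit b p q (suc N)) (β ^ suc N)

-- Partial (b,β)-content of x = p/q: Σ_{i=-N}^{N} x_i β^i.
-- These are nondecreasing in N and c_{b,β}(p/q) is their supremum (limit).
partialContent : (b β p q N : ℕ) → ℚ
partialContent b β p q N = intPart b β p q N ℚ.+ fracPart b β p q N

-- c_{b,β}(p/q) ≥ r, i.e. sup_N partialContent N ≥ r: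
-- for every rational ε > 0 some partial sum exceeds r - ε.
ContentAtLeast : (b β p q : ℕ) → ℚ → Set
ContentAtLeast b β p q r =
  (ε : ℚ) → 0ℚ ℚ.< ε → ∃[ N ] (r ℚ.- ε ℚ.< partialContent b β p q N)

module Submission where

-- The content c(D) is at least the contribution x₁/β + x₂/β² + x₃/β³ of the first three
-- fractional digits of D/d in base b.  These come from long division, b rᵢ₋₁ = d xᵢ + rᵢ with
-- r₀ = D and 0 ≤ rᵢ < d, and since b − β = D, reading the digits in base β gives
--   d (x₁β² + x₂β + x₃) + r₃ = D (bβ² + r₁β + r₂).
-- With g = b − d, m = ⌊gD/d⌋ and r₁ = gD − md, the claim becomes a polynomial inequality over ℤ
-- whose excess is (d−1) + β·slack + (β−1)D r₂ + (β−1)(d−1−r₃).  The slack is written as a sum of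
-- manifestly nonnegative terms in cases on g − m; the case g = m + 2 needs β(g−1) ≥ D, which is
-- where hypothesis (1) or (2) enters, and they also rule out g ≤ m + 1 except for d = g = D + 1,
-- where the division terminates after one digit and the excess factors as D(D+2)²(D+1)(D−1).

open import Defs
open import Data.Nat using (ℕ; NonZero)
open import Data.Product using (_×_; _,_; proj₁; proj₂)
open import Data.Sum using (_⊎_; [_,_]′; fromInj₁; map₁)
open import Function using (_∘_)
open import Relation.Binary.PropositionalEquality
open import Relation.Binary.Definitions using (tri<; tri≈; tri>)
open import Relation.Nullary using (yes; no; contradiction)

module Content where
  open import Data.Nat using (zero; suc; _+_; _*_; _^_; _≤_; pred)
  open import Data.Nat.Properties using (m^n≢0; m*n≢0)
  open import Data.Nat.Tactic.RingSolver using (solve-∀)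
  open import Data.Integer as ℤ using (+_)
  import Data.Integer.Properties as ℤP
  open import Data.Rational as ℚ using (0ℚ)
  import Data.Rational.Properties as ℚP
  open import Data.Rational.Unnormalised as ℚᵘ using (mkℚᵘ; *≤*; *≡*)
  import Data.Rational.Unnormalised.Properties as ℚᵘP

  toℚᵘ-frac : ∀ p q .{{_ : NonZero q}} → ℚ.toℚᵘ (frac p q) ℚᵘ.≃ mkℚᵘ (+ p) (pred q)
  toℚᵘ-frac p (suc q) = ℚP.toℚᵘ-fromℚᵘ (mkℚᵘ (+ p) q)

  frac-cong : ∀ {p q p′ q′} .{{_ : NonZero q}} .{{_ : NonZero q′}} →
              p * q′ ≡ p′ * q → frac p q ≡ frac p′ q′
  frac-cong {p} {suc q} {p′} {suc q′} eq = ℚP.toℚᵘ-injective (begin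
    ℚ.toℚᵘ (frac p (suc q))    ≈⟨ toℚᵘ-frac p (suc q) ⟩
    mkℚᵘ (+ p) q               ≈⟨ *≡* cross ⟩
    mkℚᵘ (+ p′) q′             ≈⟨ ℚᵘP.≃-sym (toℚᵘ-frac p′ (suc q′)) ⟩
    ℚ.toℚᵘ (frac p′ (suc q′))  ∎)
    where
    open ℚᵘP.≃-Reasoning
    cross : + p ℤ.* + suc q′ ≡ + p′ ℤ.* + suc q
    cross = trans (sym (ℤP.pos-* p (suc q′))) (trans (cong +_ eq) (ℤP.pos-* p′ (suc q)))

  frac-mono : ∀ {p q p′ q′} .{{_ : NonZero q}} .{{_ : NonZero q′}} →
              p * q′ ≤ p′ * q → frac p q ℚ.≤ frac p′ q′
  frac-mono {p} {suc q} {p′} {suc q′} le = ℚP.toℚᵘ-cancel-≤ (begin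
    ℚ.toℚᵘ (frac p (suc q))    ≃⟨ toℚᵘ-frac p (suc q) ⟩
    mkℚᵘ (+ p) q               ≤⟨ *≤* (subst₂ ℤ._≤_ (ℤP.pos-* p (suc q′)) (ℤP.pos-* p′ (suc q)) (ℤ.+≤+ le)) ⟩
    mkℚᵘ (+ p′) q′             ≃⟨ ℚᵘP.≃-sym (toℚᵘ-frac p′ (suc q′)) ⟩
    ℚ.toℚᵘ (frac p′ (suc q′))  ∎)
    where open ℚᵘP.≤-Reasoning

  frac-+ : ∀ p q p′ q′ .{{_ : NonZero q}} .{{_ : NonZero q′}} →
           frac p q ℚ.+ frac p′ q′ ≡ frac (p * q′ + p′ * q) (q * q′)
  frac-+ p (suc q) p′ (suc q′) = ℚP.toℚᵘ-injective (begin
    ℚ.toℚᵘ (frac p (suc q) ℚ.+ frac p′ (suc q′))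
      ≈⟨ ℚP.toℚᵘ-homo-+ (frac p (suc q)) (frac p′ (suc q′)) ⟩
    ℚ.toℚᵘ (frac p (suc q)) ℚᵘ.+ ℚ.toℚᵘ (frac p′ (suc q′))
      ≈⟨ ℚᵘP.+-cong (toℚᵘ-frac p (suc q)) (toℚᵘ-frac p′ (suc q′)) ⟩
    mkℚᵘ (+ p) q ℚᵘ.+ mkℚᵘ (+ p′) q′
      ≈⟨ *≡* (cong (ℤ._* + (suc q * suc q′)) numerator) ⟩
    mkℚᵘ (+ (p * suc q′ + p′ * suc q)) (pred (suc q * suc q′))
      ≈⟨ ℚᵘP.≃-sym (toℚᵘ-frac _ (suc q * suc q′)) ⟩
    ℚ.toℚᵘ (frac (p * suc q′ + p′ * suc q) (suc q * suc q′)) ∎)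
    where
    open ℚᵘP.≃-Reasoning
    numerator : + p ℤ.* + suc q′ ℤ.+ + p′ ℤ.* + suc q ≡ + (p * suc q′ + p′ * suc q)
    numerator = sym (trans (ℤP.pos-+ (p * suc q′) (p′ * suc q))
                           (cong₂ ℤ._+_ (ℤP.pos-* p (suc q′)) (ℤP.pos-* p′ (suc q))))

  frac-nonNeg : ∀ p q → 0ℚ ℚ.≤ frac p q
  frac-nonNeg p zero    = ℚP.≤-refl
  frac-nonNeg p (suc q) = ℚP.nonNegative⁻¹ _ {{ℚP.normalize-nonNeg p (suc q)}}

  intPart-nonNeg : ∀ b β p q N → 0ℚ ℚ.≤ intPart b β p q N
  intPart-nonNeg b β p q zero    = frac-nonNeg (intDigit b p q 0) 1
  intPart-nonNeg b β p q (suc N) = ℚP.+-mono-≤ (intPart-nonNeg b β p q N)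
                                     (frac-nonNeg (intDigit b p q (suc N) * β ^ suc N) 1)

  fracNumerator : (b β p q N : ℕ) → ℕ
  fracNumerator b β p q zero    = 0
  fracNumerator b β p q (suc N) = fracNumerator b β p q N * β + fracDigit b p q (suc N)

  fracPart≡frac-fracNumerator : ∀ b β p q N .{{_ : NonZero β}} →
    fracPart b β p q N ≡ frac (fracNumerator b β p q N) (β ^ N)
  fracPart≡frac-fracNumerator b β p q zero    = refl
  fracPart≡frac-fracNumerator b β p q (suc N) = begin
    fracPart b β p q N ℚ.+ frac x (β ^ suc N)
      ≡⟨ cong (ℚ._+ frac x (β ^ suc N)) (fracPart≡frac-fracNumerator b β p q N) ⟩
    frac h (β ^ N) ℚ.+ frac x (β ^ suc N)
      ≡⟨ frac-+ h (β ^ N) x (β ^ suc N) ⟩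
    frac (h * β ^ suc N + x * β ^ N) (β ^ N * β ^ suc N)
      ≡⟨ frac-cong {q = β ^ N * β ^ suc N} {q′ = β ^ suc N} (cancel-β^N h x β (β ^ N)) ⟩
    frac (h * β + x) (β ^ suc N) ∎
    where
    open ≡-Reasoning
    instance
      β^N-nonZero : NonZero (β ^ N)
      β^N-nonZero = m^n≢0 β N
      β^1+N-nonZero : NonZero (β ^ suc N)
      β^1+N-nonZero = m^n≢0 β (suc N)
      product-nonZero : NonZero (β ^ N * β ^ suc N)
      product-nonZero = m*n≢0 (β ^ N) (β ^ suc N)
    h x : ℕ
    h = fracNumerator b β p q N
    x = fracDigit b p q (suc N)
    cancel-β^N : ∀ h x β P → (h * (β * P) + x * P) * (β * P) ≡ (h * β + x) * (P * (β * P))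
    cancel-β^N = solve-∀

  fracNumerator≤partialContent : ∀ b β p q N .{{_ : NonZero β}} →
    frac (fracNumerator b β p q N) (β ^ N) ℚ.≤ partialContent b β p q N
  fracNumerator≤partialContent b β p q N = begin
    frac (fracNumerator b β p q N) (β ^ N)  ≡⟨ fracPart≡frac-fracNumerator b β p q N ⟨
    fracPart b β p q N                      ≡⟨ ℚP.+-identityˡ (fracPart b β p q N) ⟨
    0ℚ ℚ.+ fracPart b β p q N               ≤⟨ ℚP.+-monoˡ-≤ (fracPart b β p q N) (intPart-nonNeg b β p q N) ⟩
    partialContent b β p q N                ∎
    where open ℚP.≤-Reasoning

  contentAtLeast : ∀ {b β p q r} N → r ℚ.≤ partialContent b β p q N → ContentAtLeast b β p q r
  contentAtLeast {r = r} N r≤c ε 0<ε = N , ℚP.<-≤-trans r-ε<r r≤c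
    where
    r-ε<r : r ℚ.- ε ℚ.< r
    r-ε<r = subst (r ℚ.- ε ℚ.<_) (ℚP.+-identityʳ r) (ℚP.+-mono-≤-< (ℚP.≤-refl {r}) (ℚP.neg-antimono-< 0<ε))

  contentAtLeast-fracNumerator : ∀ {b β p q n m} N .{{_ : NonZero β}} .{{_ : NonZero m}} →
    n * β ^ N ≤ fracNumerator b β p q N * m → ContentAtLeast b β p q (frac n m)
  contentAtLeast-fracNumerator {b} {β} {p} {q} N le =
    contentAtLeast N (ℚP.≤-trans (frac-mono le) (fracNumerator≤partialContent b β p q N))
    where
    instance
      β^N-nonZero : NonZero (β ^ N)
      β^N-nonZero = m^n≢0 β N

module LongDivision (b p q : ℕ) .{{_ : NonZero b}} .{{_ : NonZero q}} where
  open import Data.Nat using (suc; _+_; _*_; _^_; _<_)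
  open import Data.Nat.Properties using (*-comm; *-monoʳ-<)
  open import Data.Nat.DivMod hiding (_div_; _mod_)
  open import Data.Nat.Divisibility using (divides)
  open import Data.Nat.Tactic.RingSolver using (solve-∀)

  quotient remainder : ℕ → ℕ
  quotient  k = (p * b ^ k) / q
  remainder k = (p * b ^ k) % q

  remainder<divisor : ∀ k → remainder k < q
  remainder<divisor k = m%n<n (p * b ^ k) q

  shift-dividend : ∀ k → p * b ^ suc k ≡ b * remainder k + (b * quotient k) * q
  shift-dividend k = begin
    p * (b * b ^ k)                         ≡⟨ swap p b (b ^ k) ⟩
    b * (p * b ^ k)                         ≡⟨ cong (b *_) (m≡m%n+[m/n]*n (p * b ^ k) q) ⟩
    b * (remainder k + quotient k * q)      ≡⟨ distrib b (remainder k) (quotient k) q ⟩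
    b * remainder k + (b * quotient k) * q  ∎
    where
    open ≡-Reasoning
    swap : ∀ x y z → x * (y * z) ≡ y * (x * z)
    swap = solve-∀
    distrib : ∀ x r y z → x * (r + y * z) ≡ x * r + (x * y) * z
    distrib = solve-∀

  remainder-suc : ∀ k → remainder (suc k) ≡ (b * remainder k) % q
  remainder-suc k = trans (%-congˡ (shift-dividend k)) ([m+kn]%n≡m%n (b * remainder k) (b * quotient k) q)

  fracDigit-suc : ∀ k → fracDigit b p q (suc k) ≡ (b * remainder k) / q
  fracDigit-suc k = begin
    ((p * b ^ suc k) div q) mod b
      ≡⟨ trans (mod≡% _ b) (%-congˡ (div≡/ (p * b ^ suc k) q)) ⟩
    ((p * b ^ suc k) / q) % b
      ≡⟨ %-congˡ (/-congˡ (shift-dividend k)) ⟩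
    ((b * remainder k + (b * quotient k) * q) / q) % b
      ≡⟨ %-congˡ (+-distrib-/-∣ʳ (b * remainder k) (divides (b * quotient k) refl)) ⟩
    ((b * remainder k) / q + (b * quotient k) * q / q) % b
      ≡⟨ %-congˡ (cong ((b * remainder k) / q +_) (trans (m*n/n≡m (b * quotient k) q) (*-comm b (quotient k)))) ⟩
    ((b * remainder k) / q + quotient k * b) % b
      ≡⟨ [m+kn]%n≡m%n _ (quotient k) b ⟩
    ((b * remainder k) / q) % b
      ≡⟨ m<n⇒m%n≡m (m<n*o⇒m/o<n (*-monoʳ-< b (remainder<divisor k))) ⟩
    (b * remainder k) / q ∎
    where
    open ≡-Reasoning
    div≡/ : ∀ m n .{{_ : NonZero n}} → m div n ≡ m / n
    div≡/ m (suc n) = refl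
    mod≡% : ∀ m n .{{_ : NonZero n}} → m mod n ≡ m % n
    mod≡% m (suc n) = refl

  long-division-step : ∀ k → b * remainder k ≡ remainder (suc k) + fracDigit b p q (suc k) * q
  long-division-step k = begin
    b * remainder k                                    ≡⟨ m≡m%n+[m/n]*n (b * remainder k) q ⟩
    (b * remainder k) % q + (b * remainder k) / q * q  ≡⟨ cong₂ (λ r x → r + x * q) (remainder-suc k) (fracDigit-suc k) ⟨
    remainder (suc k) + fracDigit b p q (suc k) * q    ∎
    where open ≡-Reasoning

module Excess where
  open import Data.Nat as ℕ using ()
  open import Data.Integer
  import Data.Integer.Properties as ℤP
  open import Data.Integer.Tactic.RingSolver using (solve-∀)

  0≤+n : ∀ n → 0ℤ ≤ + n
  0≤+n n = +≤+ ℕ.z≤n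

  0≤i+j : ∀ {i j} → 0ℤ ≤ i → 0ℤ ≤ j → 0ℤ ≤ i + j
  0≤i+j = ℤP.+-mono-≤

  0≤i*j : ∀ {i j} → 0ℤ ≤ i → 0ℤ ≤ j → 0ℤ ≤ i * j
  0≤i*j {+ m} {+ n} _ _ = subst (0ℤ ≤_) (ℤP.pos-* m n) (0≤+n (m ℕ.* n))

  0≤n-m : ∀ {m n} → m ℕ.≤ n → 0ℤ ≤ + n - + m
  0≤n-m m≤n = ℤP.i≤j⇒0≤j-i (+≤+ m≤n)

  0≤n-1-m : ∀ {m n} → m ℕ.< n → 0ℤ ≤ + n - 1ℤ - + m
  0≤n-1-m {m} {n} m<n = subst (0ℤ ≤_) (sub-+ (+ n) 1ℤ (+ m)) (0≤n-m m<n)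
    where
    sub-+ : ∀ i j l → i - (j + l) ≡ i - j - l
    sub-+ = solve-∀

  m+n≡o⇒+m≡+o-+n : ∀ {m n o} → m ℕ.+ n ≡ o → + m ≡ + o - + n
  m+n≡o⇒+m≡+o-+n {m} {n} refl = add-sub (+ m) (+ n)
    where
    add-sub : ∀ i j → i ≡ i + j - j
    add-sub = solve-∀

  slack : (D d g m β r₁ : ℤ) → ℤ
  slack D d g m β r₁ = D * (β * (d * (g - + 2 - m) + g * (g - 1ℤ)) - r₁) - (d - 1ℤ)

  slack-nonNeg-m+3≤g : ∀ {D d g m β r₁} → β ≡ d + g - D → r₁ ≡ g * D - m * d →
    0ℤ ≤ g - (m + + 3) → 0ℤ ≤ D - 1ℤ → 0ℤ ≤ d - 1ℤ → 0ℤ ≤ d - 1ℤ - r₁ →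
    0ℤ ≤ β - + 2 → 0ℤ ≤ β → 0ℤ ≤ d → 0ℤ ≤ g → 0ℤ ≤ g - 1ℤ → 0ℤ ≤ slack D d g m β r₁
  slack-nonNeg-m+3≤g {D} {d} {g} {m} refl refl 0≤h 0≤D-1 0≤d-1 0≤d-1-r₁ 0≤β-2 0≤β 0≤d 0≤g 0≤g-1 =
    subst (0ℤ ≤_) (sym (decomposition D d g m)) (0≤i+j (0≤i*j 0≤D-1 (0≤i+j 0≤Y 0≤d-1)) 0≤Y)
    where
    decomposition : ∀ D d g m → let β = d + g - D ; r₁ = g * D - m * d ; h = g - (m + + 3)
                                    Y = β * d * h + (β - + 2) * d + β * g * (g - 1ℤ) + (d - 1ℤ - r₁) + + 2 in
      D * (β * (d * (g - + 2 - m) + g * (g - 1ℤ)) - r₁) - (d - 1ℤ) ≡ (D - 1ℤ) * (Y + (d - 1ℤ)) + Y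
    decomposition = solve-∀
    0≤Y : 0ℤ ≤ (d + g - D) * d * (g - (m + + 3)) + (d + g - D - + 2) * d
                 + (d + g - D) * g * (g - 1ℤ) + (d - 1ℤ - (g * D - m * d)) + + 2
    0≤Y = 0≤i+j (0≤i+j (0≤i+j (0≤i+j (0≤i*j (0≤i*j 0≤β 0≤d) 0≤h) (0≤i*j 0≤β-2 0≤d)) (0≤i*j (0≤i*j 0≤β 0≤g) 0≤g-1))
                       0≤d-1-r₁) (0≤+n 2)

  slack-nonNeg-g≡m+2 : ∀ {D d g m β r₁} → β ≡ d + g - D → r₁ ≡ g * D - m * d → g ≡ m + + 2 →
    0ℤ ≤ m - 1ℤ → 0ℤ ≤ β * (g - 1ℤ) - D → 0ℤ ≤ D - 1ℤ → 0ℤ ≤ D → 0ℤ ≤ m → 0ℤ ≤ d →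
    0ℤ ≤ slack D d g m β r₁
  slack-nonNeg-g≡m+2 {D} {d} {g} {m} refl refl refl 0≤m-1 0≤β[g-1]-D 0≤D-1 0≤D 0≤m 0≤d =
    subst (0ℤ ≤_) (sym (decomposition D d m))
      (0≤i+j (0≤i+j (0≤i+j (0≤i*j (0≤i*j 0≤D (0≤i+j 0≤m (0≤+n 2))) 0≤β[g-1]-D) (0≤i*j (0≤i*j 0≤D-1 0≤m) 0≤d))
                    (0≤i*j 0≤m-1 0≤d))
             (0≤+n 1))
    where
    decomposition : ∀ D d m → let g = m + + 2 ; β = d + g - D ; r₁ = g * D - m * d in
      D * (β * (d * (g - + 2 - m) + g * (g - 1ℤ)) - r₁) - (d - 1ℤ)
        ≡ D * g * (β * (g - 1ℤ) - D) + (D - 1ℤ) * m * d + (m - 1ℤ) * d + 1ℤ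
    decomposition = solve-∀

  slack-nonNeg-g≡2 : ∀ {D d g m β r₁} → β ≡ d + g - D → r₁ ≡ g * D - m * d → g ≡ + 2 → m ≡ 0ℤ →
    0ℤ ≤ d - 1ℤ - r₁ → 0ℤ ≤ D - 1ℤ → 0ℤ ≤ D → 0ℤ ≤ slack D d g m β r₁
  slack-nonNeg-g≡2 {D} {d} refl refl refl refl 0≤d-1-r₁ 0≤D-1 0≤D =
    subst (0ℤ ≤_) (sym (decomposition D d)) (0≤i+j (0≤i*j (0≤+n 4) 0≤D) (0≤i*j (0≤i+j 0≤D-1 0≤D) 0≤d-1-r₁))
    where
    decomposition : ∀ D d → let g = + 2 ; m = 0ℤ ; β = d + g - D ; r₁ = g * D - m * d in
      D * (β * (d * (g - + 2 - m) + g * (g - 1ℤ)) - r₁) - (d - 1ℤ) ≡ + 4 * D + ((D - 1ℤ) + D) * (d - 1ℤ - r₁)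
    decomposition = solve-∀

  0≤β[g-1]-D-if-d≤g : ∀ {D d g β} → β ≡ d + g - D →
    0ℤ ≤ β → 0ℤ ≤ g - + 2 → 0ℤ ≤ d - 1ℤ - D → 0ℤ ≤ g - D → 0ℤ ≤ β * (g - 1ℤ) - D
  0≤β[g-1]-D-if-d≤g {D} {d} {g} refl 0≤β 0≤g-2 0≤d-1-D 0≤g-D =
    subst (0ℤ ≤_) (sym (decomposition D d g)) (0≤i+j (0≤i+j (0≤i+j (0≤i*j 0≤β 0≤g-2) 0≤d-1-D) 0≤g-D) (0≤+n 1))
    where
    decomposition : ∀ D d g → let β = d + g - D in
      β * (g - 1ℤ) - D ≡ β * (g - + 2) + (d - 1ℤ - D) + (g - D) + 1ℤ
    decomposition = solve-∀

  0≤β[g-1]-D-if-D*g+d≤d*g : ∀ {D d g β} → β ≡ d + g - D →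
    0ℤ ≤ d * g - (D * g + d) → 0ℤ ≤ g → 0ℤ ≤ g - 1ℤ → 0ℤ ≤ β * (g - 1ℤ) - D
  0≤β[g-1]-D-if-D*g+d≤d*g {D} {d} {g} refl 0≤d*g-[D*g+d] 0≤g 0≤g-1 =
    subst (0ℤ ≤_) (sym (decomposition D d g)) (0≤i+j 0≤d*g-[D*g+d] (0≤i*j 0≤g 0≤g-1))
    where
    decomposition : ∀ D d g → let β = d + g - D in
      β * (g - 1ℤ) - D ≡ (d * g - (D * g + d)) + g * (g - 1ℤ)
    decomposition = solve-∀

  three-digit-inequality : ∀ {D d g m b β k r₁ r₂ r₃} →
    b ≡ d + g → β ≡ d + g - D → k ≡ β - 1ℤ → r₁ ≡ g * D - m * d → 0ℤ ≤ slack D d g m β r₁ →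
    0ℤ ≤ d - 1ℤ → 0ℤ ≤ β → 0ℤ ≤ k → 0ℤ ≤ D → 0ℤ ≤ r₂ → 0ℤ ≤ d - 1ℤ - r₃ →
    d * (D * (β + 1ℤ) * (β * β)) + k * r₃ ≤ k * (b * D * (β * β) + D * (r₁ * β + r₂))
  three-digit-inequality {D} {d} {g} {m} {r₂ = r₂} {r₃} refl refl refl refl
                         0≤slack 0≤d-1 0≤β 0≤k 0≤D 0≤r₂ 0≤d-1-r₃ =
    ℤP.0≤i-j⇒j≤i (subst (0ℤ ≤_) (sym (decomposition D d g m r₂ r₃))
      (0≤i+j (0≤i+j (0≤i+j 0≤d-1 (0≤i*j 0≤β 0≤slack)) (0≤i*j (0≤i*j 0≤k 0≤D) 0≤r₂)) (0≤i*j 0≤k 0≤d-1-r₃)))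
    where
    decomposition : ∀ D d g m r₂ r₃ → let β = d + g - D ; k = β - 1ℤ ; r₁ = g * D - m * d
                                          s = D * (β * (d * (g - + 2 - m) + g * (g - 1ℤ)) - r₁) - (d - 1ℤ) in
      k * ((d + g) * D * (β * β) + D * (r₁ * β + r₂)) - (d * (D * (β + 1ℤ) * (β * β)) + k * r₃)
        ≡ (d - 1ℤ) + β * s + k * D * r₂ + k * (d - 1ℤ - r₃)
    decomposition = solve-∀

  three-digit-inequality-degenerate : ∀ {D d g m b β k r₁ r₂ r₃} →
    b ≡ d + g → β ≡ d + g - D → k ≡ β - 1ℤ → r₁ ≡ g * D - m * d →
    d ≡ 1ℤ + D → g ≡ 1ℤ + D → m ≡ D → r₂ ≡ 0ℤ → r₃ ≡ 0ℤ → 0ℤ ≤ D - 1ℤ → 0ℤ ≤ D →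
    d * (D * (β + 1ℤ) * (β * β)) + k * r₃ ≤ k * (b * D * (β * β) + D * (r₁ * β + r₂))
  three-digit-inequality-degenerate {D} refl refl refl refl refl refl refl refl refl 0≤D-1 0≤D =
    ℤP.0≤i-j⇒j≤i (subst (0ℤ ≤_) (sym (decomposition D))
      (0≤i*j (0≤i*j (0≤i*j (0≤i*j 0≤D 0≤D+2) 0≤D+2) (0≤i+j 0≤D (0≤+n 1))) 0≤D-1))
    where
    0≤D+2 : 0ℤ ≤ D + + 2
    0≤D+2 = 0≤i+j 0≤D (0≤+n 2)
    decomposition : ∀ D → let d = 1ℤ + D ; g = 1ℤ + D ; β = d + g - D ; k = β - 1ℤ ; r₁ = g * D - D * d in
      k * ((d + g) * D * (β * β) + D * (r₁ * β + 0ℤ)) - (d * (D * (β + 1ℤ) * (β * β)) + k * 0ℤ)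
        ≡ D * (D + + 2) * (D + + 2) * (D + 1ℤ) * (D - 1ℤ)
    decomposition = solve-∀

  drop-three-digit-inequality : ∀ D d b β k r₁ r₂ r₃ →
    + d * (+ D * (+ β + 1ℤ) * (+ β * + β)) + + k * + r₃
      ≤ + k * (+ b * + D * (+ β * + β) + + D * (+ r₁ * + β + + r₂)) →
    d ℕ.* (D ℕ.* (β ℕ.+ 1) ℕ.* (β ℕ.* β)) ℕ.+ k ℕ.* r₃
      ℕ.≤ k ℕ.* (b ℕ.* D ℕ.* (β ℕ.* β) ℕ.+ D ℕ.* (r₁ ℕ.* β ℕ.+ r₂))
  drop-three-digit-inequality D d b β k r₁ r₂ r₃ = ℤP.drop‿+≤+ ∘ subst₂ _≤_ (sym left) (sym right)
    where
    p : ∀ m n → + (m ℕ.* n) ≡ + m * + n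
    p = ℤP.pos-*
    left : + (d ℕ.* (D ℕ.* (β ℕ.+ 1) ℕ.* (β ℕ.* β)) ℕ.+ k ℕ.* r₃)
             ≡ + d * (+ D * (+ β + 1ℤ) * (+ β * + β)) + + k * + r₃
    left = cong₂ _+_ (trans (p d _) (cong (+ d *_) (trans (p (D ℕ.* (β ℕ.+ 1)) (β ℕ.* β))
                                                         (cong₂ _*_ (p D (β ℕ.+ 1)) (p β β)))))
                     (p k r₃)
    right : + (k ℕ.* (b ℕ.* D ℕ.* (β ℕ.* β) ℕ.+ D ℕ.* (r₁ ℕ.* β ℕ.+ r₂)))
              ≡ + k * (+ b * + D * (+ β * + β) + + D * (+ r₁ * + β + + r₂))
    right = trans (p k _) (cong (+ k *_) (cong₂ _+_
              (trans (p (b ℕ.* D) (β ℕ.* β)) (cong₂ _*_ (p b D) (p β β)))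
              (trans (p D _) (cong (λ x → + D * (x + + r₂)) (p r₁ β)))))

open import Data.Nat using (suc; z≤n; s≤s; s≤s⁻¹; _+_; _*_; _∸_; _^_; _≤_; _<_; _≥_; _>_; >-nonZero)
open import Data.Nat.Properties
open import Data.Nat.Tactic.RingSolver using (solve-∀)
open import Data.Integer as ℤ using (+_; 0ℤ; 1ℤ)
import Data.Integer.Properties as ℤP
open import Data.Nat.DivMod using (%-congˡ; m<n⇒m%n≡m)
open Content using (fracNumerator; contentAtLeast-fracNumerator)
open Excess

rebase-long-division : ∀ {b β c d r₀ r₁ r₂ r₃ x₁ x₂ x₃} → b ≡ β + c →
  b * r₀ ≡ r₁ + x₁ * d → b * r₁ ≡ r₂ + x₂ * d → b * r₂ ≡ r₃ + x₃ * d →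
  d * ((x₁ * β + x₂) * β + x₃) + r₃ ≡ b * r₀ * (β * β) + c * (r₁ * β + r₂)
rebase-long-division {b} {β} {c} {d} {r₀} {r₁} {r₂} {r₃} {x₁} {x₂} {x₃} refl step₁ step₂ step₃ =
  +-cancelʳ-≡ ((r₁ * β + r₂) * β) _ _ (begin
    d * ((x₁ * β + x₂) * β + x₃) + r₃ + (r₁ * β + r₂) * β
      ≡⟨ regroup r₁ r₂ r₃ x₁ x₂ x₃ d β ⟩
    (r₁ + x₁ * d) * (β * β) + (r₂ + x₂ * d) * β + (r₃ + x₃ * d)
      ≡⟨ cong (λ w → (r₁ + x₁ * d) * (β * β) + (r₂ + x₂ * d) * β + w) step₃ ⟨
    (r₁ + x₁ * d) * (β * β) + (r₂ + x₂ * d) * β + b * r₂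
      ≡⟨ cong₂ (λ u v → u * (β * β) + v * β + b * r₂) step₁ step₂ ⟨
    b * r₀ * (β * β) + b * r₁ * β + b * r₂
      ≡⟨ split-base r₀ r₁ r₂ β c ⟩
    b * r₀ * (β * β) + c * (r₁ * β + r₂) + (r₁ * β + r₂) * β ∎)
  where
  open ≡-Reasoning
  regroup : ∀ r₁ r₂ r₃ x₁ x₂ x₃ d β →
    d * ((x₁ * β + x₂) * β + x₃) + r₃ + (r₁ * β + r₂) * β
      ≡ (r₁ + x₁ * d) * (β * β) + (r₂ + x₂ * d) * β + (r₃ + x₃ * d)
  regroup = solve-∀
  split-base : ∀ r₀ r₁ r₂ β c → let b = β + c in
    b * r₀ * (β * β) + b * r₁ * β + b * r₂ ≡ b * r₀ * (β * β) + c * (r₁ * β + r₂) + (r₁ * β + r₂) * β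
  split-base = solve-∀

module ThreeDigitBound
  {b d g D β k x₁ x₂ x₃ r₁ r₂ r₃ : ℕ}
  (b≡d+g : b ≡ d + g) (β+D≡b : β + D ≡ b) (k+1≡β : k + 1 ≡ β)
  (step₁ : b * D ≡ r₁ + x₁ * d) (step₂ : b * r₁ ≡ r₂ + x₂ * d) (step₃ : b * r₂ ≡ r₃ + x₃ * d)
  (r₁<d : r₁ < d) (r₃<d : r₃ < d) (1≤D : 1 ≤ D) (D<d : D < d) (2≤g : 2 ≤ g)
  (d≤g⊎D*g+d<d*g : d ≤ g ⊎ D * g + d < d * g)
  where

  1≤d : 1 ≤ d
  1≤d = ≤-trans 1≤D (<⇒≤ D<d)

  instance
    d-nonZero : NonZero d
    d-nonZero = >-nonZero 1≤d

  D≤x₁ : D ≤ x₁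
  D≤x₁ = s≤s⁻¹ (*-cancelʳ-< d D (suc x₁) (begin-strict
    D * d        ≤⟨ *-monoʳ-≤ D (subst (d ≤_) (sym b≡d+g) (m≤m+n d g)) ⟩
    D * b        ≡⟨ *-comm D b ⟩
    b * D        ≡⟨ step₁ ⟩
    r₁ + x₁ * d  <⟨ +-monoˡ-< (x₁ * d) r₁<d ⟩
    d + x₁ * d   ∎))
    where open ≤-Reasoning

  m : ℕ
  m = x₁ ∸ D

  r₁+m*d≡g*D : r₁ + m * d ≡ g * D
  r₁+m*d≡g*D = +-cancelˡ-≡ (d * D) _ _ (begin
    d * D + (r₁ + m * d)  ≡⟨ regroup d D r₁ m ⟩
    r₁ + (D + m) * d      ≡⟨ cong (λ x → r₁ + x * d) (m+[n∸m]≡n D≤x₁) ⟩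
    r₁ + x₁ * d           ≡⟨ step₁ ⟨
    b * D                 ≡⟨ cong (_* D) b≡d+g ⟩
    (d + g) * D           ≡⟨ *-distribʳ-+ D d g ⟩
    d * D + g * D         ∎)
    where
    open ≡-Reasoning
    regroup : ∀ d D r₁ m → d * D + (r₁ + m * d) ≡ r₁ + (D + m) * d
    regroup = solve-∀

  g≤β : g ≤ β
  g≤β = +-cancelʳ-≤ D g β (begin
    g + D  ≤⟨ +-monoʳ-≤ g (<⇒≤ D<d) ⟩
    g + d  ≡⟨ +-comm g d ⟩
    d + g  ≡⟨ trans β+D≡b b≡d+g ⟨
    β + D  ∎)
    where open ≤-Reasoning

  b≡d+gᶻ : + b ≡ + d ℤ.+ + g
  b≡d+gᶻ = cong +_ b≡d+g

  β≡d+g-Dᶻ : + β ≡ + d ℤ.+ + g ℤ.- + D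
  β≡d+g-Dᶻ = m+n≡o⇒+m≡+o-+n (trans β+D≡b b≡d+g)

  k≡β-1ᶻ : + k ≡ + β ℤ.- 1ℤ
  k≡β-1ᶻ = m+n≡o⇒+m≡+o-+n k+1≡β

  r₁≡g*D-m*dᶻ : + r₁ ≡ + g ℤ.* + D ℤ.- + m ℤ.* + d
  r₁≡g*D-m*dᶻ = trans (m+n≡o⇒+m≡+o-+n r₁+m*d≡g*D) (cong₂ ℤ._-_ (ℤP.pos-* g D) (ℤP.pos-* m d))

  KeyInequality : Set
  KeyInequality = d * (D * (β + 1) * (β * β)) + k * r₃ ≤ k * (b * D * (β * β) + D * (r₁ * β + r₂))

  key-inequality-from-slack : 0ℤ ℤ.≤ slack (+ D) (+ d) (+ g) (+ m) (+ β) (+ r₁) → KeyInequality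
  key-inequality-from-slack 0≤slack = drop-three-digit-inequality D d b β k r₁ r₂ r₃
    (three-digit-inequality {+ D} {+ d} {+ g} {+ m} {+ b} {+ β} {+ k} {+ r₁} {+ r₂} {+ r₃}
       b≡d+gᶻ β≡d+g-Dᶻ k≡β-1ᶻ r₁≡g*D-m*dᶻ
       0≤slack (0≤n-m 1≤d) (0≤+n β) (0≤+n k) (0≤+n D) (0≤+n r₂) (0≤n-1-m r₃<d))

  g*d≤g*D+d : g ≤ suc m → g * d ≤ g * D + d
  g*d≤g*D+d g≤1+m = begin
    g * d             ≤⟨ *-monoˡ-≤ d g≤1+m ⟩
    d + m * d         ≤⟨ +-monoʳ-≤ d (m≤n+m (m * d) r₁) ⟩
    d + (r₁ + m * d)  ≡⟨ cong (λ x → d + x) r₁+m*d≡g*D ⟩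
    d + g * D         ≡⟨ +-comm d (g * D) ⟩
    g * D + d         ∎
    where open ≤-Reasoning

  maximal-first-digit⇒d≡g≡1+D : g ≤ suc m → d ≡ suc D × g ≡ suc D
  maximal-first-digit⇒d≡g≡1+D g≤1+m = d≡1+D , trans (≤-antisym g≤d d≤g) d≡1+D
    where
    open ≤-Reasoning
    d≤g : d ≤ g
    d≤g = fromInj₁ (contradiction d*g≤D*g+d ∘ <⇒≱) d≤g⊎D*g+d<d*g
      where
      d*g≤D*g+d : d * g ≤ D * g + d
      d*g≤D*g+d = subst₂ _≤_ (*-comm g d) (cong (_+ d) (*-comm g D)) (g*d≤g*D+d g≤1+m)
    g≤d : g ≤ d
    g≤d = +-cancelˡ-≤ (g * D) g d (begin
      g * D + g  ≡⟨ trans (+-comm (g * D) g) (sym (*-suc g D)) ⟩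
      g * suc D  ≤⟨ *-monoʳ-≤ g D<d ⟩
      g * d      ≤⟨ g*d≤g*D+d g≤1+m ⟩
      g * D + d  ∎)
    d≡1+D : d ≡ suc D
    d≡1+D = ≤-antisym (*-cancelˡ-≤ d (begin
      d * d      ≤⟨ *-monoˡ-≤ d d≤g ⟩
      g * d      ≤⟨ g*d≤g*D+d g≤1+m ⟩
      g * D + d  ≤⟨ +-monoˡ-≤ d (*-monoˡ-≤ D g≤d) ⟩
      d * D + d  ≡⟨ trans (+-comm (d * D) d) (sym (*-suc d D)) ⟩
      d * suc D  ∎)) D<d

  -- Here the slack is negative for D = 1; instead all three remainders vanish.
  key-inequality-degenerate : g ≤ suc m → KeyInequality
  key-inequality-degenerate g≤1+m = drop-three-digit-inequality D d b β k r₁ r₂ r₃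
    (three-digit-inequality-degenerate {+ D} {+ d} {+ g} {+ m} {+ b} {+ β} {+ k} {+ r₁} {+ r₂} {+ r₃}
       b≡d+gᶻ β≡d+g-Dᶻ k≡β-1ᶻ r₁≡g*D-m*dᶻ
       (cong +_ d≡1+D) (cong +_ g≡1+D) (cong +_ m≡D) (cong +_ r₂≡0) (cong +_ r₃≡0) (0≤n-m 1≤D) (0≤+n D))
    where
    d≡1+D : d ≡ suc D
    d≡1+D = proj₁ (maximal-first-digit⇒d≡g≡1+D g≤1+m)
    g≡d : g ≡ d
    g≡d = trans (proj₂ (maximal-first-digit⇒d≡g≡1+D g≤1+m)) (sym d≡1+D)
    g≡1+D : g ≡ suc D
    g≡1+D = trans g≡d d≡1+D
    r₁+m*d≡D*d : r₁ + m * d ≡ D * d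
    r₁+m*d≡D*d = trans r₁+m*d≡g*D (trans (cong (_* D) g≡d) (*-comm d D))
    r₁≡0 : r₁ ≡ 0
    r₁≡0 = n≤0⇒n≡0 (+-cancelʳ-≤ (m * d) r₁ 0
             (subst (_≤ m * d) (sym r₁+m*d≡D*d) (*-monoˡ-≤ d (s≤s⁻¹ (subst (_≤ suc m) g≡1+D g≤1+m)))))
    m≡D : m ≡ D
    m≡D = *-cancelʳ-≡ m D d (trans (cong (_+ m * d) (sym r₁≡0)) r₁+m*d≡D*d)
    remainder-vanishes : ∀ {r r′ x} → b * r ≡ r′ + x * d → r ≡ 0 → r′ ≡ 0
    remainder-vanishes {r′ = r′} step refl = m+n≡0⇒m≡0 r′ (trans (sym step) (*-zeroʳ b))
    r₂≡0 : r₂ ≡ 0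
    r₂≡0 = remainder-vanishes {x = x₂} step₂ r₁≡0
    r₃≡0 : r₃ ≡ 0
    r₃≡0 = remainder-vanishes {x = x₃} step₃ r₂≡0

  0≤β[g-1]-D : 0ℤ ℤ.≤ + β ℤ.* (+ g ℤ.- 1ℤ) ℤ.- + D
  0≤β[g-1]-D = [ from-d≤g , from-D*g+d<d*g ]′ d≤g⊎D*g+d<d*g
    where
    from-d≤g : d ≤ g → 0ℤ ℤ.≤ + β ℤ.* (+ g ℤ.- 1ℤ) ℤ.- + D
    from-d≤g d≤g = 0≤β[g-1]-D-if-d≤g {+ D} {+ d} {+ g} β≡d+g-Dᶻ
      (0≤+n β) (0≤n-m 2≤g) (0≤n-1-m D<d) (0≤n-m (≤-trans (<⇒≤ D<d) d≤g))
    from-D*g+d<d*g : D * g + d < d * g → 0ℤ ℤ.≤ + β ℤ.* (+ g ℤ.- 1ℤ) ℤ.- + D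
    from-D*g+d<d*g D*g+d<d*g = 0≤β[g-1]-D-if-D*g+d≤d*g {+ D} {+ d} {+ g} β≡d+g-Dᶻ
      (subst₂ (λ x y → 0ℤ ℤ.≤ x ℤ.- (y ℤ.+ + d)) (ℤP.pos-* d g) (ℤP.pos-* D g) (0≤n-m (<⇒≤ D*g+d<d*g)))
      (0≤+n g) (0≤n-m (≤-trans (s≤s z≤n) 2≤g))

  slack-nonNeg-2+m≡g : 2 + m ≡ g → 0ℤ ℤ.≤ slack (+ D) (+ d) (+ g) (+ m) (+ β) (+ r₁)
  slack-nonNeg-2+m≡g 2+m≡g with m ≟ 0
  ... | yes m≡0 = slack-nonNeg-g≡2 {+ D} {+ d} {+ g} {+ m} β≡d+g-Dᶻ r₁≡g*D-m*dᶻ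
                    (cong +_ (trans (sym 2+m≡g) (cong (λ x → 2 + x) m≡0))) (cong +_ m≡0)
                    (0≤n-1-m r₁<d) (0≤n-m 1≤D) (0≤+n D)
  ... | no m≢0  = slack-nonNeg-g≡m+2 {+ D} {+ d} {+ g} {+ m} β≡d+g-Dᶻ r₁≡g*D-m*dᶻ
                    (cong +_ (trans (sym 2+m≡g) (+-comm 2 m))) (0≤n-m (n≢0⇒n>0 m≢0)) 0≤β[g-1]-D
                    (0≤n-m 1≤D) (0≤+n D) (0≤+n m) (0≤+n d)

  slack-nonNeg-2+m<g : 2 + m < g → 0ℤ ℤ.≤ slack (+ D) (+ d) (+ g) (+ m) (+ β) (+ r₁)
  slack-nonNeg-2+m<g 3+m≤g = slack-nonNeg-m+3≤g {+ D} {+ d} {+ g} {+ m} β≡d+g-Dᶻ r₁≡g*D-m*dᶻ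
    (0≤n-m (subst (_≤ g) (+-comm 3 m) 3+m≤g)) (0≤n-m 1≤D) (0≤n-m 1≤d) (0≤n-1-m r₁<d)
    (0≤n-m (≤-trans 2≤g g≤β)) (0≤+n β) (0≤+n d) (0≤+n g) (0≤n-m (≤-trans (s≤s z≤n) 2≤g))

  key-inequality : KeyInequality
  key-inequality with <-cmp (2 + m) g
  ... | tri< 2+m<g _ _ = key-inequality-from-slack (slack-nonNeg-2+m<g 2+m<g)
  ... | tri≈ _ 2+m≡g _ = key-inequality-from-slack (slack-nonNeg-2+m≡g 2+m≡g)
  ... | tri> _ _ g<2+m = key-inequality-degenerate (s≤s⁻¹ g<2+m)

  three-digit-bound : D * (β + 1) * (β * β) ≤ ((x₁ * β + x₂) * β + x₃) * k
  three-digit-bound = *-cancelˡ-≤ d (+-cancelʳ-≤ (k * r₃) _ _ (begin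
    d * (D * (β + 1) * (β * β)) + k * r₃        ≤⟨ key-inequality ⟩
    k * (b * D * (β * β) + D * (r₁ * β + r₂))    ≡⟨ cong (k *_) rebased ⟨
    k * (d * ((x₁ * β + x₂) * β + x₃) + r₃)      ≡⟨ distribute k d ((x₁ * β + x₂) * β + x₃) r₃ ⟩
    d * (((x₁ * β + x₂) * β + x₃) * k) + k * r₃  ∎))
    where
    open ≤-Reasoning
    rebased : d * ((x₁ * β + x₂) * β + x₃) + r₃ ≡ b * D * (β * β) + D * (r₁ * β + r₂)
    rebased = rebase-long-division {β = β} {D} {d} {x₁ = x₁} {x₂} {x₃} (sym β+D≡b) step₁ step₂ step₃
    distribute : ∀ k d h r → k * (d * h + r) ≡ d * (h * k) + k * r
    distribute = solve-∀

first-three-digits-bound : ∀ {b d g D β k} .{{_ : NonZero b}} →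
  b ≡ d + g → β + D ≡ b → k + 1 ≡ β → 1 ≤ D → D < d → 2 ≤ g → d ≤ g ⊎ D * g + d < d * g →
  D * (β + 1) * β ^ 3 ≤ fracNumerator b β D d 3 * (β * k)
first-three-digits-bound {b} {d} {g} {D} {β} {k} b≡d+g β+D≡b k+1≡β 1≤D D<d 2≤g d≤g⊎D*g+d<d*g =
  subst₂ _≤_ (times-β³ D β) (times-β H β k) (*-monoʳ-≤ β three-digit-bound)
  where
  instance
    d-nonZero : NonZero d
    d-nonZero = >-nonZero (≤-trans 1≤D (<⇒≤ D<d))
  open LongDivision b D d
  digit : ℕ → ℕ
  digit = fracDigit b D d
  H : ℕ
  H = fracNumerator b β D d 3
  remainder₀≡D : remainder 0 ≡ D
  remainder₀≡D = trans (%-congˡ {o = d} (*-identityʳ D)) (m<n⇒m%n≡m D<d)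
  three-digit-bound : D * (β + 1) * (β * β) ≤ H * k
  three-digit-bound = ThreeDigitBound.three-digit-bound {x₁ = digit 1} {digit 2} {digit 3}
    b≡d+g β+D≡b k+1≡β
    (subst (λ r → b * r ≡ remainder 1 + digit 1 * d) remainder₀≡D (long-division-step 0))
    (long-division-step 1) (long-division-step 2) (remainder<divisor 1) (remainder<divisor 3)
    1≤D D<d 2≤g d≤g⊎D*g+d<d*g
  times-β³ : ∀ D β → β * (D * (β + 1) * (β * β)) ≡ D * (β + 1) * (β * (β * (β * 1)))
  times-β³ = solve-∀
  times-β : ∀ H β k → β * (H * k) ≡ H * (β * k)
  times-β = solve-∀

proposition8p11 : (b d D : ℕ) →
    b ≥ d → d ≥ D → D ≥ 1 → b ≥ 2 → d > 1 → b ∸ D ≥ 2 →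
    D < d → d ≤ b ∸ 2 →
    (2 * d ≤ b ⊎ D * (b ∸ d) + d < d * (b ∸ d)) →
    ContentAtLeast b (b ∸ D) D d
      (frac (D * ((b ∸ D) + 1)) ((b ∸ D) * ((b ∸ D) ∸ 1)))
proposition8p11 b d D d≤b D≤d 1≤D 2≤b _ 2≤β D<d d≤b∸2 2*d≤b⊎gap =
  contentAtLeast-fracNumerator 3 (first-three-digits-bound
    (sym (m+[n∸m]≡n d≤b)) (m∸n+n≡m (≤-trans D≤d d≤b)) (m∸n+n≡m 1≤β) 1≤D D<d 2≤g d≤g⊎gap)
  where
  β g : ℕ
  β = b ∸ D
  g = b ∸ d
  1≤β : 1 ≤ β
  1≤β = ≤-trans (s≤s z≤n) 2≤β
  instance
    b-nonZero : NonZero b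
    b-nonZero = >-nonZero (≤-trans (s≤s z≤n) 2≤b)
    β-nonZero : NonZero β
    β-nonZero = >-nonZero 1≤β
    β-1-nonZero : NonZero (β ∸ 1)
    β-1-nonZero = >-nonZero (m<n⇒0<n∸m 2≤β)
    β*[β-1]-nonZero : NonZero (β * (β ∸ 1))
    β*[β-1]-nonZero = m*n≢0 β (β ∸ 1)
  2≤g : 2 ≤ g
  2≤g = m+n≤o⇒m≤o∸n 2 (subst (_≤ b) (+-comm d 2) (m≤o∸n⇒m+n≤o d 2≤b d≤b∸2))
  d≤g⊎gap : d ≤ g ⊎ D * g + d < d * g
  d≤g⊎gap = map₁ (λ 2*d≤b → m+n≤o⇒m≤o∸n d (subst (_≤ b) (cong (λ x → d + x) (+-identityʳ d)) 2*d≤b))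
                 2*d≤b⊎gap
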